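{- For all positive integers $n$, $k$, and $l$ with $k>l$, \[ \max_{d\mid n}\left\{\alpha(\mathbb{Z}_d,\{k,l\})\cdot\frac{n}{d}\right\} \;=\; \max_{d\mid n}\left\{\gamma(\mathbb{Z}_d,\{k,l\})\cdot\frac{n}{d}\right\}. \]
   Context: For a subset $A$ of $\mathbb{Z}_d$ and a positive integer $h$, $hA$ denotes the $h$-fold sumset $\{a_1+\cdots+a_h : a_i\in A\}$. For positive integers $k>l$, $A$ is $(k,l)$-sum-free if $kA\cap lA=\emptyset$. An arithmetic progression in $\mathbb{Z}_d$ is a set $\{a+i\cdot b : i=0,1,\dots,m-1\}$ with $m$ a positive integer, $a,b\in\mathbb{Z}_d$ and $m\le d/\gcd(d,b)$ (so it has exactly $m$ elements); when $m=1$ one takes $b=1$. $\alpha(\mathbb{Z}_d,\{k,l\})$ is the maximum size of a $(k,l)$-sum-free arithmetic progression in $\mathbb{Z}_d$, and $\gamma(\mathbb{Z}_d,\{k,l\})$ is the maximum size of a $(k,l)$-sum-free arithmetic progression in $\mathbb{Z}_d$ whose common difference $b$ satisfies $\gcd(b,d)=1$ (each taken to be $0$ if there is none). -}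

module Defs where

open import Data.Nat using (ℕ; zero; suc; _+_; _*_; _≤_; _<_; ∣_-_∣)
open import Data.Nat.Divisibility using (_∣_)
open import Data.Nat.GCD using (gcd)
open import Data.Nat.Coprimality using (Coprime)
open import Data.Fin using (Fin; toℕ)
open import Data.Sum using (_⊎_)
open import Data.Product using (Σ; ∃; ∃-syntax; _×_)
open import Relation.Binary.PropositionalEquality using (_≡_)
open import Relation.Nullary using (¬_)

sumFin : ∀ {h} → (Fin h → ℕ) → ℕ
sumFin {zero}  f = 0
sumFin {suc h} f = f Data.Fin.zero + sumFin (λ i → f (Data.Fin.suc i))

_≡_[mod_] : ℕ → ℕ → ℕ → Set
x ≡ y [mod d ] = d ∣ ∣ x - y ∣

-- The arithmetic progression {a + i·b : i = 0,…,m-1} in ℤ_d, where a, b are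
-- natural-number representatives of elements of ℤ_d.  Element i is:
apElem : (a b : ℕ) → ∀ {m} → Fin m → ℕ
apElem a b i = a + toℕ i * b

-- Validity of the data (a, b, m) as an arithmetic progression in ℤ_d:
-- m ≥ 1, m ≤ d / gcd(d,b) (written with the exact quotient e = d / gcd(d,b)),
-- and b = 1 when m = 1.
IsAP : (d a b m : ℕ) → Set
IsAP d a b m =
  1 ≤ m ×
  (∃[ e ] (d ≡ e * gcd d b × m ≤ e)) ×
  (m ≡ 1 → b ≡ 1 [mod d ])

InSumset : (d h a b m x : ℕ) → Set
InSumset d h a b m x =
  Σ (Fin h → Fin m) λ f → x ≡ sumFin {h} (λ j → apElem a b {m} (f j)) [mod d ]

SumFree : (d k l a b m : ℕ) → Set
SumFree d k l a b m = ¬ (∃[ x ] (InSumset d k a b m x × InSumset d l a b m x))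

IsMax : (ℕ → Set) → ℕ → Set
IsMax P v = P v × (∀ w → P w → w ≤ v)

-- Sizes attained by (k,l)-sum-free arithmetic progressions in ℤ_d,
-- together with 0 (the convention when there is none).
AlphaSizes : (d k l : ℕ) → ℕ → Set
AlphaSizes d k l m =
  (m ≡ 0) ⊎ (∃[ a ] ∃[ b ] (IsAP d a b m × SumFree d k l a b m))

GammaSizes : (d k l : ℕ) → ℕ → Set
GammaSizes d k l m =
  (m ≡ 0) ⊎ (∃[ a ] ∃[ b ] (IsAP d a b m × Coprime b d × SumFree d k l a b m))

IsAlpha : (d k l m : ℕ) → Set
IsAlpha d k l m = IsMax (AlphaSizes d k l) m

IsGamma : (d k l m : ℕ) → Set
IsGamma d k l m = IsMax (GammaSizes d k l) m

-- The set { α(ℤ_d,{k,l}) · (n/d) : d ∣ n }, with n = q·d so that n/d = q.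
AlphaValues : (n k l : ℕ) → ℕ → Set
AlphaValues n k l v =
  ∃[ d ] ∃[ q ] ∃[ m ] (n ≡ q * d × IsAlpha d k l m × v ≡ m * q)

GammaValues : (n k l : ℕ) → ℕ → Set
GammaValues n k l v =
  ∃[ d ] ∃[ q ] ∃[ m ] (n ≡ q * d × IsGamma d k l m × v ≡ m * q)

-- Write r = k − l. Since kA − lA = r·a + {s·b − t·b : s ≤ k(m−1), t ≤ l(m−1)}, the progression
-- A = {a + i·b : i < m} is (k,l)-sum-free in ℤ_d iff r·a + s·b ≢ t·b for all such s, t.
-- Put g = gcd(d,b), d = e·g, b = b′·g, so that m ≤ e. If g ∤ r·a, the single point {a} is already
-- sum-free in ℤ_g, and m ≤ e = d/g. Otherwise r·a = c·g, the condition descends to ℤ_e, where b′ is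
-- invertible, and for the residue w ≡ c·b′⁻¹ it forces l(m−1) < w < e − k(m−1). With
-- h = gcd(r,e): if h ∣ c then r·x ≡ w is solvable and the interval {x, …, x+m−1} is sum-free in ℤ_e;
-- if h ∤ c then {a} is sum-free in ℤ_{gh} and m ≤ e/h. In each case m·(n/d) ≤ m′·(n/d′) for a
-- sum-free interval of size m′ in some ℤ_{d′} with d′ ∣ d, and intervals have difference 1, coprime
-- to the modulus. So both maxima equal the largest value m′·(n/d′) attained by such intervals.

module Submission where

open import Defs
open import Data.Nat using (ℕ; _≤_; _<_)
open import Data.Product using (_,_; proj₁; proj₂; ∃-syntax; _×_)

module ModularIntegers where
  open import Data.Nat as ℕ using (ℕ; zero; suc; NonZero)
  import Data.Nat.Properties as ℕₚ
  import Data.Nat.Divisibility as ℕ∣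
  open import Data.Nat.GCD using (gcd; gcd-GCD; module Bézout)
  open import Data.Integer using (ℤ; +_; 0ℤ; _+_; _-_; _*_; -_; _⊖_; ∣_∣)
  import Data.Integer.Properties as ℤₚ
  open import Data.Nat.Coprimality using (Coprime; coprime-divisor)
  open import Data.Integer.Divisibility.Signed
    using (_∣_; _∣?_; divides; ∣ᵤ⇒∣; ∣⇒∣ᵤ; ∣-trans; ∣m∣n⇒∣m+n; ∣n⇒∣m*n)
  import Data.Integer.Divisibility as ℤ∣ᵤ
  open import Data.Integer.DivMod using (_%ℕ_; _/ℕ_; n%ℕd<d; a≡a%ℕn+[a/ℕn]*n)
  open import Data.Integer.Tactic.RingSolver using (solve-∀)
  open import Data.Product using (_,_; ∃-syntax; _×_)
  open import Relation.Binary.Bundles using (Setoid)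
  open import Relation.Binary.PropositionalEquality
  open import Relation.Nullary using (¬_; Dec)
  open import Relation.Nullary.Decidable using (map′)

  -- Congruence of integers, so that residues can be subtracted without truncation.
  infix 4 _≡_[ℤmod_]
  record _≡_[ℤmod_] (X Y : ℤ) (d : ℕ) : Set where
    constructor mkℤmod
    field ∣difference : + d ∣ X - Y
  open _≡_[ℤmod_] public

  ℤmod? : ∀ d X Y → Dec (X ≡ Y [ℤmod d ])
  ℤmod? d X Y = map′ mkℤmod ∣difference (+ d ∣? X - Y)

  ℤmod-by : ∀ {d X Y} Q → X ≡ Y + Q * + d → X ≡ Y [ℤmod d ]
  ℤmod-by {d} {X} {Y} Q eq = mkℤmod (divides Q (trans (cong (_- Y) eq) (cancel Y Q (+ d))))
    where
    cancel : ∀ y q e → y + q * e - y ≡ q * e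
    cancel = solve-∀

  ℤmod-refl : ∀ {d X} → X ≡ X [ℤmod d ]
  ℤmod-refl {d} {X} = mkℤmod (divides 0ℤ (ℤₚ.+-inverseʳ X))

  ℤmod-sym : ∀ {d X Y} → X ≡ Y [ℤmod d ] → Y ≡ X [ℤmod d ]
  ℤmod-sym {d} {X} {Y} (mkℤmod (divides Q eq)) = mkℤmod (divides (- Q) (begin
    Y - X       ≡⟨ negate X Y ⟩
    - (X - Y)   ≡⟨ cong -_ eq ⟩
    - (Q * + d) ≡⟨ ℤₚ.neg-distribˡ-* Q (+ d) ⟩
    - Q * + d   ∎))
    where
    open ≡-Reasoning
    negate : ∀ x y → y - x ≡ - (x - y)
    negate = solve-∀

  ℤmod-trans : ∀ {d X Y Z} → X ≡ Y [ℤmod d ] → Y ≡ Z [ℤmod d ] → X ≡ Z [ℤmod d ]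
  ℤmod-trans {d} {X} {Y} {Z} (mkℤmod p) (mkℤmod q) =
    mkℤmod (subst (+ d ∣_) (split X Y Z) (∣m∣n⇒∣m+n p q))
    where
    split : ∀ x y z → (x - y) + (y - z) ≡ x - z
    split = solve-∀

  ℤmod-setoid : ℕ → Setoid _ _
  ℤmod-setoid d = record
    { Carrier = ℤ
    ; _≈_ = λ X Y → X ≡ Y [ℤmod d ]
    ; isEquivalence = record { refl = ℤmod-refl ; sym = ℤmod-sym ; trans = ℤmod-trans }
    }

  +-difference : ∀ Z X Y → (Z + X) - (Z + Y) ≡ X - Y
  +-difference = solve-∀

  *-difference : ∀ K X Y → K * (X - Y) ≡ K * X - K * Y
  *-difference = solve-∀

  ℤmod-+ˡ : ∀ {d X Y} Z → X ≡ Y [ℤmod d ] → Z + X ≡ Z + Y [ℤmod d ]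
  ℤmod-+ˡ {d} {X} {Y} Z (mkℤmod p) = mkℤmod (subst (+ d ∣_) (sym (+-difference Z X Y)) p)

  ℤmod-+ʳ : ∀ {d X Y} Z → X ≡ Y [ℤmod d ] → X + Z ≡ Y + Z [ℤmod d ]
  ℤmod-+ʳ {d} {X} {Y} Z c =
    subst₂ (λ U V → U ≡ V [ℤmod d ]) (ℤₚ.+-comm Z X) (ℤₚ.+-comm Z Y) (ℤmod-+ˡ Z c)

  ℤmod-+ˡ⁻¹ : ∀ {d X Y} Z → Z + X ≡ Z + Y [ℤmod d ] → X ≡ Y [ℤmod d ]
  ℤmod-+ˡ⁻¹ {d} {X} {Y} Z (mkℤmod p) = mkℤmod (subst (+ d ∣_) (+-difference Z X Y) p)

  ℤmod-*ˡ : ∀ {d X Y} K → X ≡ Y [ℤmod d ] → K * X ≡ K * Y [ℤmod d ]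
  ℤmod-*ˡ {d} {X} {Y} K (mkℤmod p) = mkℤmod (subst (+ d ∣_) (*-difference K X Y) (∣n⇒∣m*n K p))

  ℤmod-*-modulus : ∀ {e X Y} g → X ≡ Y [ℤmod e ] → + g * X ≡ + g * Y [ℤmod e ℕ.* g ]
  ℤmod-*-modulus {e} {X} {Y} g (mkℤmod (divides Q eq)) = mkℤmod (divides Q (begin
    + g * X - + g * Y ≡⟨ *-difference (+ g) X Y ⟨
    + g * (X - Y)     ≡⟨ cong (+ g *_) eq ⟩
    + g * (Q * + e)   ≡⟨ regroup (+ g) Q (+ e) ⟩
    Q * (+ e * + g)   ≡⟨ cong (Q *_) (ℤₚ.pos-* e g) ⟨
    Q * + (e ℕ.* g)   ∎))
    where
    open ≡-Reasoning
    regroup : ∀ g q e → g * (q * e) ≡ q * (e * g)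
    regroup = solve-∀

  %ℕ-ℤmod : ∀ {d} .{{_ : NonZero d}} X → + (X %ℕ d) ≡ X [ℤmod d ]
  %ℕ-ℤmod {d} X = ℤmod-sym (ℤmod-by (X /ℕ d) (a≡a%ℕn+[a/ℕn]*n X d))

  ∣m⊖n∣≡∣m-n∣ : ∀ m n → ∣ m ⊖ n ∣ ≡ ℕ.∣ m - n ∣
  ∣m⊖n∣≡∣m-n∣ zero    zero    = refl
  ∣m⊖n∣≡∣m-n∣ zero    (suc n) = refl
  ∣m⊖n∣≡∣m-n∣ (suc m) zero    = refl
  ∣m⊖n∣≡∣m-n∣ (suc m) (suc n) = trans (cong ∣_∣ (ℤₚ.[1+m]⊖[1+n]≡m⊖n m n)) (∣m⊖n∣≡∣m-n∣ m n)

  ∣+m-+n∣≡∣m-n∣ : ∀ m n → ∣ + m - + n ∣ ≡ ℕ.∣ m - n ∣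
  ∣+m-+n∣≡∣m-n∣ m n = trans (cong ∣_∣ (ℤₚ.m-n≡m⊖n m n)) (∣m⊖n∣≡∣m-n∣ m n)

  mod⇒ℤmod : ∀ {d x y} → x ≡ y [mod d ] → + x ≡ + y [ℤmod d ]
  mod⇒ℤmod {d} {x} {y} (ℕ∣.divides q eq) =
    mkℤmod (∣ᵤ⇒∣ (ℤ∣ᵤ.divides q (trans (∣+m-+n∣≡∣m-n∣ x y) eq)))

  ℤmod⇒mod : ∀ {d x y} → + x ≡ + y [ℤmod d ] → x ≡ y [mod d ]
  ℤmod⇒mod {d} {x} {y} (mkℤmod p) with ∣⇒∣ᵤ p
  ... | ℤ∣ᵤ.divides q eq = ℕ∣.divides q (trans (sym (∣+m-+n∣≡∣m-n∣ x y)) eq)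

  ℤmod-0⇒∣ : ∀ {d x} → + x ≡ 0ℤ [ℤmod d ] → d ℕ∣.∣ x
  ℤmod-0⇒∣ {d} {x} c = subst (d ℕ∣.∣_) (ℕₚ.∣-∣-identityʳ x) (ℤmod⇒mod c)

  ∣⇒ℤmod-0 : ∀ {d x} → d ℕ∣.∣ x → + x ≡ 0ℤ [ℤmod d ]
  ∣⇒ℤmod-0 {d} {x} d∣x = mod⇒ℤmod (subst (d ℕ∣.∣_) (sym (ℕₚ.∣-∣-identityʳ x)) d∣x)

  ℤmod-window : ∀ {d t u} → t ℕ.< u → u ℕ.< t ℕ.+ d → ¬ (+ u ≡ + t [ℤmod d ])
  ℤmod-window {d} {t} {u} t<u u<t+d c =
    ℕₚ.<⇒≱ u∸t<d (ℕ∣.∣⇒≤ ⦃ ℕ.>-nonZero (ℕₚ.m<n⇒0<n∸m t<u) ⦄ d∣u∸t)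
    where
    u∸t<d : u ℕ.∸ t ℕ.< d
    u∸t<d = ℕₚ.+-cancelˡ-< t _ _ (subst (ℕ._< t ℕ.+ d) (sym (ℕₚ.m+[n∸m]≡n (ℕₚ.<⇒≤ t<u))) u<t+d)
    d∣u∸t : d ℕ∣.∣ u ℕ.∸ t
    d∣u∸t = subst (d ℕ∣.∣_) (ℕₚ.m≤n⇒∣n-m∣≡n∸m (ℕₚ.<⇒≤ t<u)) (ℤmod⇒mod c)

  pos-+* : ∀ g y e → + (g ℕ.+ y ℕ.* e) ≡ + g + + y * + e
  pos-+* g y e = trans (ℤₚ.pos-+ g (y ℕ.* e)) (cong (_+_ (+ g)) (ℤₚ.pos-* y e))

  bézout-ℤmod : ∀ a e → ∃[ α ] (+ a * α ≡ + gcd a e [ℤmod e ])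
  bézout-ℤmod a e with gcd a e | Bézout.identity (gcd-GCD a e)
  ... | g | Bézout.+- x y eq = + x , ℤmod-by (+ y) (begin
    + a * + x       ≡⟨ ℤₚ.pos-* a x ⟨
    + (a ℕ.* x)     ≡⟨ cong +_ (trans (ℕₚ.*-comm a x) (sym eq)) ⟩
    + (g ℕ.+ y ℕ.* e) ≡⟨ pos-+* g y e ⟩
    + g + + y * + e ∎)
    where open ≡-Reasoning
  ... | g | Bézout.-+ x y eq = - + x , ℤmod-by (- + y) (solve-for-ax (+ a) (+ x) (+ y) (+ e) (+ g)
    (trans (sym (pos-+* g x a)) (trans (cong +_ eq) (ℤₚ.pos-* y e))))
    where
    solve-for-ax : ∀ A X Y E G → G + X * A ≡ Y * E → A * - X ≡ G + - Y * E
    solve-for-ax A X Y E G eq′ = trans (negated A X G) (trans (cong (_-_ G) eq′) (moved Y E G))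
      where
      negated : ∀ A X G → A * - X ≡ G - (G + X * A)
      negated = solve-∀
      moved : ∀ Y E G → G - Y * E ≡ G + - Y * E
      moved = solve-∀

  linear-congruence : ∀ a c e .{{_ : NonZero e}} → gcd a e ℕ∣.∣ c →
                      ∃[ x ] (x ℕ.< e × + (a ℕ.* x) ≡ + c [ℤmod e ])
  linear-congruence a c e (ℕ∣.divides q c≡qg) with bézout-ℤmod a e
  ... | α , aα≡g = x , n%ℕd<d (α * + q) e , (begin
    + (a ℕ.* x)        ≡⟨ ℤₚ.pos-* a x ⟩
    + a * + x          ≈⟨ ℤmod-*ˡ (+ a) (%ℕ-ℤmod (α * + q)) ⟩
    + a * (α * + q)    ≡⟨ regroup (+ a) α (+ q) ⟩
    + q * (+ a * α)    ≈⟨ ℤmod-*ˡ (+ q) aα≡g ⟩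
    + q * + gcd a e    ≡⟨ ℤₚ.pos-* q (gcd a e) ⟨
    + (q ℕ.* gcd a e)  ≡⟨ cong +_ c≡qg ⟨
    + c                ∎)
    where
    x = (α * + q) %ℕ e
    open import Relation.Binary.Reasoning.Setoid (ℤmod-setoid e)
    regroup : ∀ A α Q → A * (α * Q) ≡ Q * (A * α)
    regroup = solve-∀

  ∣-solution : ∀ {e h b c w} → h ℕ∣.∣ e → Coprime h b → + (b ℕ.* w) ≡ + c [ℤmod e ] →
               h ℕ∣.∣ c → h ℕ∣.∣ w
  ∣-solution {e} {h} {b} {c} {w} h∣e coprime (mkℤmod e∣bw-c) h∣c =
    coprime-divisor coprime (∣⇒∣ᵤ (subst (+ h ∣_) (sub-add (+ (b ℕ.* w)) (+ c))
      (∣m∣n⇒∣m+n (∣-trans (∣ᵤ⇒∣ h∣e) e∣bw-c) (∣ᵤ⇒∣ h∣c))))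
    where
    sub-add : ∀ X C → (X - C) + C ≡ X
    sub-add = solve-∀

module NaturalArithmetic where
  open import Data.Nat
  open import Data.Nat.Properties
  open import Data.Nat.GCD using (GCD; GCD-*)
  open import Data.Nat.Divisibility using (_∣_; ∣-trans)
  open import Data.Nat.Coprimality using (Coprime; GCD≡1⇒coprime)
  open import Data.Product using (_,_; ∃; ∃-syntax)
  open import Relation.Binary.PropositionalEquality
  open import Relation.Nullary using (yes; no)
  open import Relation.Unary using (Decidable)

  bounded⇒max : ∀ {P : ℕ → Set} → Decidable P → ∀ N → ∃ P → (∀ v → P v → v ≤ N) → ∃[ M ] IsMax P M
  bounded⇒max {P} P? zero (v , Pv) bound = 0 , subst P (n≤0⇒n≡0 (bound v Pv)) Pv , bound
  bounded⇒max P? (suc N) ∃P bound with P? (suc N)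
  ... | yes PN = suc N , PN , bound
  ... | no ¬PN = bounded⇒max P? N ∃P λ v Pv → s≤s⁻¹ (≤∧≢⇒< (bound v Pv) λ { refl → ¬PN Pv })

  coprime-∣ʳ : ∀ {m n d} → Coprime m n → d ∣ n → Coprime m d
  coprime-∣ʳ coprime d∣n (i∣m , i∣d) = coprime (i∣m , ∣-trans i∣d d∣n)

  coprime-quotients : ∀ {m n g} .{{_ : NonZero g}} → GCD (m * g) (n * g) g → Coprime m n
  coprime-quotients {g = g} gcd = GCD≡1⇒coprime (GCD-* (subst (GCD _ _) (sym (*-identityˡ g)) gcd))

  <-quotient : ∀ {k m n p h} → n ≡ p * h → h ≤ k → k * m < n → m < p
  <-quotient {k} {m} {n} {p} {h} n≡p*h h≤k k*m<n = *-cancelˡ-< k m p (begin-strict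
    k * m <⟨ k*m<n ⟩
    n     ≡⟨ n≡p*h ⟩
    p * h ≤⟨ *-monoʳ-≤ p h≤k ⟩
    p * k ≡⟨ *-comm p k ⟩
    k * p ∎)
    where open ≤-Reasoning

module Progressions where
  open import Data.Nat
  open import Data.Nat.Properties
  open import Data.Nat.Tactic.RingSolver using (solve-∀)
  open import Data.Fin as Fin using (Fin; toℕ; fromℕ<; fromℕ)
  import Data.Fin.Properties as Finₚ
  open import Data.Integer using (+_)
  open import Data.Product using (Σ; _,_; ∃-syntax; _×_)
  open import Data.Sum using (inj₁; inj₂)
  open import Relation.Binary.PropositionalEquality
  open import Relation.Nullary using (yes; no)
  open ModularIntegers

  sumFin-apElem : ∀ {m} a b h (f : Fin h → Fin m) →
                  sumFin (λ j → apElem a b (f j)) ≡ h * a + sumFin (λ j → toℕ (f j)) * b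
  sumFin-apElem a b zero    f = refl
  sumFin-apElem a b (suc h) f rewrite sumFin-apElem a b h (λ j → f (Fin.suc j)) =
    regroup a b h (toℕ (f Fin.zero)) (sumFin (λ j → toℕ (f (Fin.suc j))))
    where
    regroup : ∀ a b h t s → a + t * b + (h * a + s * b) ≡ a + h * a + (t + s) * b
    regroup = solve-∀

  sumFin-toℕ≤ : ∀ m₁ h (f : Fin h → Fin (suc m₁)) → sumFin (λ j → toℕ (f j)) ≤ h * m₁
  sumFin-toℕ≤ m₁ zero    f = z≤n
  sumFin-toℕ≤ m₁ (suc h) f =
    +-mono-≤ (Finₚ.toℕ≤pred[n] (f Fin.zero)) (sumFin-toℕ≤ m₁ h (λ j → f (Fin.suc j)))

  sumFin-toℕ-onto : ∀ m₁ h s → s ≤ h * m₁ →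
                    Σ (Fin h → Fin (suc m₁)) λ f → sumFin (λ j → toℕ (f j)) ≡ s
  sumFin-toℕ-onto m₁ zero    .zero z≤n = (λ ()) , refl
  sumFin-toℕ-onto m₁ (suc h) s s≤ with s ≤? m₁
  ... | yes s≤m₁ with sumFin-toℕ-onto m₁ h 0 z≤n
  ...   | f , sum≡0 = (λ { Fin.zero → fromℕ< (s≤s s≤m₁) ; (Fin.suc j) → f j }) ,
                      trans (cong₂ _+_ (Finₚ.toℕ-fromℕ< (s≤s s≤m₁)) sum≡0) (+-identityʳ s)
  sumFin-toℕ-onto m₁ (suc h) s s≤ | no s≰m₁
    with sumFin-toℕ-onto m₁ h (s ∸ m₁) (subst (s ∸ m₁ ≤_) (m+n∸m≡n m₁ (h * m₁)) (∸-monoˡ-≤ m₁ s≤))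
  ... | f , sum≡ = (λ { Fin.zero → fromℕ m₁ ; (Fin.suc j) → f j }) ,
                   trans (cong₂ _+_ (Finₚ.toℕ-fromℕ m₁) sum≡) (m+[n∸m]≡n (<⇒≤ (≰⇒> s≰m₁)))

  gammaSize⇒alphaSize : ∀ {D k l m} → GammaSizes D k l m → AlphaSizes D k l m
  gammaSize⇒alphaSize (inj₁ m≡0)                   = inj₁ m≡0
  gammaSize⇒alphaSize (inj₂ (a , b , ap , _ , sf)) = inj₂ (a , b , ap , sf)

  module _ {d h a b m₁ : ℕ} where

    inSumset-form : ∀ {x} → InSumset d h a b (suc m₁) x →
                    ∃[ s ] (s ≤ h * m₁ × + x ≡ + (h * a + s * b) [ℤmod d ])
    inSumset-form {x} (f , x≡sum) = sumFin (λ j → toℕ (f j)) , sumFin-toℕ≤ m₁ h f ,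
      subst (λ y → + x ≡ + y [ℤmod d ]) (sumFin-apElem a b h f) (mod⇒ℤmod x≡sum)

    inSumset-intro : ∀ {x s} → s ≤ h * m₁ → + x ≡ + (h * a + s * b) [ℤmod d ] →
                     InSumset d h a b (suc m₁) x
    inSumset-intro {x} {s} s≤ x≡ with sumFin-toℕ-onto m₁ h s s≤
    ... | f , sum≡s = f , ℤmod⇒mod (subst (λ y → + x ≡ + y [ℤmod d ]) sum≡ x≡)
      where
      sum≡ : h * a + s * b ≡ sumFin (λ j → apElem a b (f j))
      sum≡ = trans (cong (λ σ → h * a + σ * b) (sym sum≡s)) (sym (sumFin-apElem a b h f))

module SumFreeCriterion (k l : ℕ) (l≤k : l ≤ k) where
  open import Data.Nat
  open import Data.Nat.Properties
  open import Data.Integer as ℤ using (+_)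
  import Data.Integer.Properties as ℤₚ
  open import Data.Product using (_,_)
  open import Relation.Binary.PropositionalEquality
  open import Relation.Nullary using (¬_)
  open ModularIntegers
  open Progressions

  r : ℕ
  r = k ∸ l

  k≡l+r : k ≡ l + r
  k≡l+r = sym (m+[n∸m]≡n l≤k)

  module _ {d : ℕ} (a b : ℕ) where

    split-ka : ∀ s → + (k * a + s * b) ≡ + (l * a) ℤ.+ + (r * a + s * b)
    split-ka s = begin
      + (k * a + s * b)         ≡⟨ cong (λ κ → + (κ * a + s * b)) k≡l+r ⟩
      + ((l + r) * a + s * b)   ≡⟨ cong (λ z → + (z + s * b)) (*-distribʳ-+ a l r) ⟩
      + (l * a + r * a + s * b) ≡⟨ cong +_ (+-assoc (l * a) (r * a) (s * b)) ⟩
      + (l * a + (r * a + s * b)) ≡⟨ ℤₚ.pos-+ (l * a) (r * a + s * b) ⟩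
      + (l * a) ℤ.+ + (r * a + s * b) ∎
      where open ≡-Reasoning

    congruent-sums⇒ : ∀ {s t} → + (k * a + s * b) ≡ + (l * a + t * b) [ℤmod d ] →
                      + (r * a + s * b) ≡ + (t * b) [ℤmod d ]
    congruent-sums⇒ {s} {t} c = ℤmod-+ˡ⁻¹ (+ (l * a))
      (subst₂ (λ X Y → X ≡ Y [ℤmod d ]) (split-ka s) (ℤₚ.pos-+ (l * a) (t * b)) c)

    congruent-sums⇐ : ∀ {s t} → + (r * a + s * b) ≡ + (t * b) [ℤmod d ] →
                      + (k * a + s * b) ≡ + (l * a + t * b) [ℤmod d ]
    congruent-sums⇐ {s} {t} c =
      subst₂ (λ X Y → X ≡ Y [ℤmod d ]) (sym (split-ka s)) (sym (ℤₚ.pos-+ (l * a) (t * b)))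
        (ℤmod-+ˡ (+ (l * a)) c)

  module _ {d a b m₁ : ℕ} where

    sumFree⇒incongruent : SumFree d k l a b (suc m₁) → ∀ {s t} → s ≤ k * m₁ → t ≤ l * m₁ →
                          ¬ (+ (r * a + s * b) ≡ + (t * b) [ℤmod d ])
    sumFree⇒incongruent sf {s} {t} s≤ t≤ c =
      sf (k * a + s * b , inSumset-intro {d} {k} {a} {b} {m₁} s≤ ℤmod-refl ,
                          inSumset-intro {d} {l} {a} {b} {m₁} t≤ (congruent-sums⇐ a b {s} {t} c))

    incongruent⇒sumFree : (∀ {s t} → s ≤ k * m₁ → t ≤ l * m₁ →
                             ¬ (+ (r * a + s * b) ≡ + (t * b) [ℤmod d ])) →
                          SumFree d k l a b (suc m₁)
    incongruent⇒sumFree incongruent (x , x∈kA , x∈lA) 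
      with inSumset-form {d} {k} {a} {b} {m₁} {x} x∈kA | inSumset-form {d} {l} {a} {b} {m₁} {x} x∈lA
    ... | s , s≤ , x≡ka+sb | t , t≤ , x≡la+tb =
      incongruent s≤ t≤ (congruent-sums⇒ a b {s} {t} (ℤmod-trans (ℤmod-sym x≡ka+sb) x≡la+tb))

module Reduction (k l : ℕ) (0<l : 0 < l) (l<k : l < k) where
  open import Data.Nat
  open import Data.Nat.Properties
  open import Data.Nat.Tactic.RingSolver using (solve-∀)
  open import Data.Nat.Divisibility using (_∣_; divides; _∣?_; ∣⇒≤; 1∣_; m∣m*n; *-cancelʳ-∣)
  open import Data.Nat.GCD using (gcd; gcd-GCD; GCD; gcd[m,n]∣m; gcd[m,n]∣n; gcd[m,n]≢0)
  open import Data.Nat.Coprimality as Coprime using (Coprime; coprime⇒gcd≡1; 1-coprimeTo)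
  open import Data.Integer as ℤ using (+_; 0ℤ)
  import Data.Integer.Properties as ℤₚ
  open import Data.Integer.DivMod using (_%ℕ_; n%ℕd<d)
  open import Data.Unit using (⊤; tt)
  open import Data.Product using (_,_; proj₁; proj₂; ∃-syntax; _×_)
  open import Data.Sum using (inj₁; inj₂)
  open import Relation.Binary.PropositionalEquality
  open import Relation.Nullary using (¬_; Dec; yes; no)
  open import Relation.Nullary.Decidable using (map′; _×-dec_)
  open ModularIntegers
  open NaturalArithmetic
  open SumFreeCriterion k l (<⇒≤ l<k) public

  instance
    r≢0 : NonZero r
    r≢0 = >-nonZero (m<n⇒0<n∸m l<k)

  -- The interval {x, …, x + m₁} of ℤ_D is (k,l)-sum-free as soon as r·x ≡ y with l·m₁ < y < D ∸ k·m₁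
  -- (interval-sumFree); size 0 is always admitted, as in AlphaSizes.
  IntervalSize : ℕ → ℕ → Set
  IntervalSize D zero     = ⊤
  IntervalSize D (suc m₁) = ∃[ x ] ∃[ y ] (+ (r * x) ≡ + y [ℤmod D ] × l * m₁ < y × y + k * m₁ < D)

  interval-sumFree : ∀ {D m₁ x y} → + (r * x) ≡ + y [ℤmod D ] → l * m₁ < y → y + k * m₁ < D →
                     SumFree D k l x 1 (suc m₁)
  interval-sumFree {D} {m₁} {x} {y} rx≡y l*m₁<y y+k*m₁<D = incongruent⇒sumFree incongruent
    where
    incongruent : ∀ {s t} → s ≤ k * m₁ → t ≤ l * m₁ → ¬ (+ (r * x + s * 1) ≡ + (t * 1) [ℤmod D ])
    incongruent {s} {t} s≤ t≤ rx+s≡t = ℤmod-window t<y+s y+s<t+D (begin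
      + (y + s)          ≡⟨ ℤₚ.pos-+ y s ⟩
      + y ℤ.+ + s        ≈⟨ ℤmod-+ʳ (+ s) rx≡y ⟨
      + (r * x) ℤ.+ + s  ≡⟨ ℤₚ.pos-+ (r * x) s ⟨
      + (r * x + s)      ≡⟨ cong (λ σ → + (r * x + σ)) (*-identityʳ s) ⟨
      + (r * x + s * 1)  ≈⟨ rx+s≡t ⟩
      + (t * 1)          ≡⟨ cong +_ (*-identityʳ t) ⟩
      + t                ∎)
      where
      open import Relation.Binary.Reasoning.Setoid (ℤmod-setoid D)
      t<y+s : t < y + s
      t<y+s = <-≤-trans (≤-<-trans t≤ l*m₁<y) (m≤m+n y s)
      y+s<t+D : y + s < t + D
      y+s<t+D = <-≤-trans (≤-<-trans (+-monoʳ-≤ y s≤) y+k*m₁<D) (m≤n+m D t)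

  0<k : 0 < k
  0<k = <-trans 0<l l<k

  intervalSize≤ : ∀ {D} m → IntervalSize D m → m ≤ D
  intervalSize≤ zero     _                             = z≤n
  intervalSize≤ (suc m₁) (_ , y , _ , _ , y+k*m₁<D) =
    ≤-<-trans (≤-trans (m≤n*m m₁ k ⦃ >-nonZero 0<k ⦄) (m≤n+m (k * m₁) y)) y+k*m₁<D

  interval-isAP : ∀ {D x m} → 1 ≤ m → m ≤ D → IsAP D x 1 m
  interval-isAP {D} 1≤m m≤D =
    1≤m , (D , sym (trans (cong (D *_) gcd[D,1]≡1) (*-identityʳ D)) , m≤D) ,
    (λ _ → ℤmod⇒mod {D} {1} {1} ℤmod-refl)
    where
    gcd[D,1]≡1 : gcd D 1 ≡ 1
    gcd[D,1]≡1 = coprime⇒gcd≡1 (Coprime.sym (1-coprimeTo D))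

  intervalSize⇒gammaSize : ∀ {D} m → IntervalSize D m → GammaSizes D k l m
  intervalSize⇒gammaSize zero     _ = inj₁ refl
  intervalSize⇒gammaSize {D} (suc m₁) I@(x , _ , rx≡y , l*m₁<y , y+k*m₁<D) =
    inj₂ (x , 1 , interval-isAP {x = x} (s≤s z≤n) (intervalSize≤ (suc m₁) I) , 1-coprimeTo D ,
          interval-sumFree rx≡y l*m₁<y y+k*m₁<D)

  intervalSize? : ∀ D m → Dec (IntervalSize D m)
  intervalSize? D zero     = yes tt
  intervalSize? D (suc m₁) = map′ unbounded bounded
    (anyUpTo? (λ x → anyUpTo? (λ y →
      ℤmod? D (+ (r * x)) (+ y) ×-dec l * m₁ <? y ×-dec y + k * m₁ <? D) D) D)
    where
    unbounded : ∃[ x ] (x < D × ∃[ y ] (y < D × _)) → IntervalSize D (suc m₁)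
    unbounded (x , _ , y , _ , window) = x , y , window
    bounded : IntervalSize D (suc m₁) → ∃[ x ] (x < D × ∃[ y ] (y < D × _))
    bounded (x , y , rx≡y , l*m₁<y , y+k*m₁<D) =
      (+ x) %ℕ D , n%ℕd<d (+ x) D , y , y<D ,
      ℤmod-trans rx′≡rx rx≡y , l*m₁<y , y+k*m₁<D
      where
      y<D : y < D
      y<D = ≤-<-trans (m≤m+n y (k * m₁)) y+k*m₁<D
      instance
        D≢0 : NonZero D
        D≢0 = >-nonZero (≤-<-trans z≤n y<D)
      rx′≡rx : + (r * ((+ x) %ℕ D)) ≡ + (r * x) [ℤmod D ]
      rx′≡rx = subst₂ (λ U V → U ≡ V [ℤmod D ]) (sym (ℤₚ.pos-* r _)) (sym (ℤₚ.pos-* r x))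
                 (ℤmod-*ˡ (+ r) (%ℕ-ℤmod (+ x)))

  singleton-intervalSize : ∀ {D a} .{{_ : NonZero D}} → ¬ D ∣ r * a → IntervalSize D 1
  singleton-intervalSize {D} {a} D∤ra =
    a , y , ra≡y , subst (_< y) (sym (*-zeroʳ l)) 0<y ,
    subst (_< D) (sym y+k*0≡y) (n%ℕd<d (+ (r * a)) D)
    where
    y = (+ (r * a)) %ℕ D
    ra≡y : + (r * a) ≡ + y [ℤmod D ]
    ra≡y = ℤmod-sym (%ℕ-ℤmod (+ (r * a)))
    0<y : 0 < y
    0<y = n≢0⇒n>0 λ y≡0 → D∤ra (ℤmod-0⇒∣ (subst (λ z → + (r * a) ≡ + z [ℤmod D ]) y≡0 ra≡y))
    y+k*0≡y : y + k * 0 ≡ y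
    y+k*0≡y = trans (cong (_+_ y) (*-zeroʳ k)) (+-identityʳ y)

  -- Take s = 0, t = w for the lower bound and s = e ∸ w, t = 0 for the upper one.
  residue-window : ∀ {e c b′ w m₁} →
                   (∀ {s t} → s ≤ k * m₁ → t ≤ l * m₁ → ¬ (+ (c + s * b′) ≡ + (t * b′) [ℤmod e ])) →
                   w ≤ e → + (b′ * w) ≡ + c [ℤmod e ] → l * m₁ < w × w + k * m₁ < e
  residue-window {e} {c} {b′} {w} {m₁} incongruent w≤e b′w≡c =
    ≰⇒> (λ w≤l*m₁ → incongruent z≤n w≤l*m₁ c≡wb′) ,
    ≰⇒> (λ e≤w+k*m₁ → incongruent (m≤n+o⇒m∸n≤o e w e≤w+k*m₁) z≤n c+[e∸w]b′≡0)
    where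
    open import Relation.Binary.Reasoning.Setoid (ℤmod-setoid e)
    factor : ∀ b′ w u → b′ * w + u * b′ ≡ (u + w) * b′
    factor = solve-∀
    c≡wb′ : + (c + 0 * b′) ≡ + (w * b′) [ℤmod e ]
    c≡wb′ = begin
      + (c + 0 * b′) ≡⟨ cong +_ (+-identityʳ c) ⟩
      + c            ≈⟨ b′w≡c ⟨
      + (b′ * w)     ≡⟨ cong +_ (*-comm b′ w) ⟩
      + (w * b′)     ∎
    c+[e∸w]b′≡0 : + (c + (e ∸ w) * b′) ≡ + (0 * b′) [ℤmod e ]
    c+[e∸w]b′≡0 = begin
      + (c + (e ∸ w) * b′)            ≡⟨ ℤₚ.pos-+ c _ ⟩
      + c ℤ.+ + ((e ∸ w) * b′)        ≈⟨ ℤmod-+ʳ (+ ((e ∸ w) * b′)) b′w≡c ⟨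
      + (b′ * w) ℤ.+ + ((e ∸ w) * b′) ≡⟨ ℤₚ.pos-+ (b′ * w) _ ⟨
      + (b′ * w + (e ∸ w) * b′)       ≡⟨ cong +_ (factor b′ w (e ∸ w)) ⟩
      + ((e ∸ w + w) * b′)            ≡⟨ cong (λ z → + (z * b′)) (m∸n+n≡m w≤e) ⟩
      + (e * b′)                      ≈⟨ ∣⇒ℤmod-0 (m∣m*n b′) ⟩
      0ℤ                              ∎

  -- After rescaling by n/d for any multiple n of d, the size m in ℤ_d is at most the size m′ of an
  -- interval in the quotient ℤ_d′, rescaled by n/d′.
  Dominated : ℕ → ℕ → Set
  Dominated d m = ∃[ d′ ] ∃[ p ] ∃[ m′ ] (d ≡ p * d′ × m ≤ m′ * p × IntervalSize d′ m′)

  module _ {d a b m₁ e g b′ c : ℕ} (d≡e*g : d ≡ e * g) (b≡b′*g : b ≡ b′ * g) (ra≡c*g : r * a ≡ c * g)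
           (sf : SumFree d k l a b (suc m₁)) where

    reduced-incongruent : ∀ {s t} → s ≤ k * m₁ → t ≤ l * m₁ →
                          ¬ (+ (c + s * b′) ≡ + (t * b′) [ℤmod e ])
    reduced-incongruent {s} {t} s≤ t≤ congruent = sumFree⇒incongruent sf s≤ t≤
      (subst₂ (λ X Y → X ≡ Y [ℤmod d ]) pos-lhs pos-rhs
        (subst (λ D → _ ≡ _ [ℤmod D ]) (sym d≡e*g) (ℤmod-*-modulus g congruent)))
      where
      lhs : g * (c + s * b′) ≡ r * a + s * b
      lhs = begin
        g * (c + s * b′)    ≡⟨ regroup c s b′ g ⟩
        c * g + s * (b′ * g) ≡⟨ cong₂ (λ x y → x + s * y) ra≡c*g b≡b′*g ⟨
        r * a + s * b       ∎
        where
        open ≡-Reasoning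
        regroup : ∀ c s b′ g → g * (c + s * b′) ≡ c * g + s * (b′ * g)
        regroup = solve-∀
      rhs : g * (t * b′) ≡ t * b
      rhs = trans (*-comm g (t * b′)) (trans (*-assoc t b′ g) (cong (t *_) (sym b≡b′*g)))
      pos-lhs : + g ℤ.* + (c + s * b′) ≡ + (r * a + s * b)
      pos-lhs = trans (sym (ℤₚ.pos-* g _)) (cong +_ lhs)
      pos-rhs : + g ℤ.* + (t * b′) ≡ + (t * b)
      pos-rhs = trans (sym (ℤₚ.pos-* g _)) (cong +_ rhs)

    solvable-dominated : ∀ {w} .{{_ : NonZero g}} .{{_ : NonZero e}} → Coprime b′ e →
                         + (b′ * w) ≡ + c [ℤmod e ] → l * m₁ < w × w + k * m₁ < e → gcd r e ∣ c →
                         Dominated d (suc m₁)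
    solvable-dominated {w} coprime b′w≡c window h∣c =
      e , g , suc m₁ , trans d≡e*g (*-comm e g) , m≤m*n (suc m₁) g , x , w , rx≡w , window
      where
      h∣e : gcd r e ∣ e
      h∣e = gcd[m,n]∣n r e
      h∣w : gcd r e ∣ w
      h∣w = ∣-solution {e} {gcd r e} {b′} {c} {w} h∣e (Coprime.sym (coprime-∣ʳ coprime h∣e)) b′w≡c h∣c
      x : ℕ
      x = proj₁ (linear-congruence r w e h∣w)
      rx≡w : + (r * x) ≡ + w [ℤmod e ]
      rx≡w = proj₂ (proj₂ (linear-congruence r w e h∣w))

    unsolvable-dominated : .{{_ : NonZero g}} → ¬ gcd r e ∣ c → k * m₁ < e → Dominated d (suc m₁)
    unsolvable-dominated h∤c k*m₁<e with gcd[m,n]∣n r e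
    ... | divides p e≡p*h =
      g * h , p , 1 , d≡p*[g*h] ,
      subst (suc m₁ ≤_) (sym (*-identityˡ p)) (<-quotient e≡p*h h≤k k*m₁<e) ,
      singleton-intervalSize ⦃ m*n≢0 g h ⦄ gh∤ra
      where
      h = gcd r e
      instance
        h≢0 : NonZero h
        h≢0 = ≢-nonZero (gcd[m,n]≢0 r e (inj₁ (≢-nonZero⁻¹ r)))
      h≤k : h ≤ k
      h≤k = ≤-trans (∣⇒≤ (gcd[m,n]∣m r e)) (m∸n≤m k l)
      d≡p*[g*h] : d ≡ p * (g * h)
      d≡p*[g*h] = trans d≡e*g (trans (cong (_* g) e≡p*h) (regroup p h g))
        where
        regroup : ∀ p h g → p * h * g ≡ p * (g * h)
        regroup = solve-∀
      gh∤ra : ¬ g * h ∣ r * a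
      gh∤ra gh∣ra = h∤c (*-cancelʳ-∣ g (subst₂ _∣_ (*-comm g h) ra≡c*g gh∣ra))

    divisible-dominated : .{{_ : NonZero g}} → suc m₁ ≤ e → Coprime b′ e → Dominated d (suc m₁)
    divisible-dominated m≤e coprime = by-cases (gcd r e ∣? c)
      where
      instance
        e≢0 : NonZero e
        e≢0 = >-nonZero (<-≤-trans z<s m≤e)
      residue : ∃[ w ] (w < e × + (b′ * w) ≡ + c [ℤmod e ])
      residue = linear-congruence b′ c e (subst (_∣ c) (sym (coprime⇒gcd≡1 coprime)) (1∣ c))
      w : ℕ
      w = proj₁ residue
      b′w≡c : + (b′ * w) ≡ + c [ℤmod e ]
      b′w≡c = proj₂ (proj₂ residue)
      window : l * m₁ < w × w + k * m₁ < e
      window = residue-window reduced-incongruent (<⇒≤ (proj₁ (proj₂ residue))) b′w≡c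
      by-cases : Dec (gcd r e ∣ c) → Dominated d (suc m₁)
      by-cases (yes h∣c) = solvable-dominated coprime b′w≡c window h∣c
      by-cases (no h∤c)  = unsolvable-dominated h∤c (≤-<-trans (m≤n+m (k * m₁) w) (proj₂ window))

  sumFreeAP⇒dominated : ∀ {d a b m} → 0 < d → IsAP d a b m → SumFree d k l a b m → Dominated d m
  sumFreeAP⇒dominated {m = zero} _ (() , _) _
  sumFreeAP⇒dominated {d} {a} {b} {suc m₁} 0<d (_ , (e , d≡e*g , m≤e) , _) sf =
    by-cases (gcd d b ∣? r * a)
    where
    instance
      g≢0 : NonZero (gcd d b)
      g≢0 = ≢-nonZero (gcd[m,n]≢0 d b (inj₁ (≢-nonZero⁻¹ d ⦃ >-nonZero 0<d ⦄)))
    open _∣_ (gcd[m,n]∣n d b) renaming (quotient to b′; equality to b≡b′*g)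
    by-cases : Dec (gcd d b ∣ r * a) → Dominated d (suc m₁)
    by-cases (no g∤ra) =
      gcd d b , e , 1 , d≡e*g , subst (suc m₁ ≤_) (sym (*-identityˡ e)) m≤e ,
      singleton-intervalSize g∤ra
    by-cases (yes (divides c ra≡c*g)) =
      divisible-dominated {e = e} {b′ = b′} {c} d≡e*g b≡b′*g ra≡c*g sf m≤e
      (Coprime.sym (coprime-quotients (subst₂ (λ x y → GCD x y (gcd d b)) d≡e*g b≡b′*g (gcd-GCD d b))))

module MaximalValues (n k l : ℕ) (0<n : 0 < n) (0<l : 0 < l) (l<k : l < k) where
  open import Data.Nat
  open import Data.Nat.Properties
  open import Data.Nat.Tactic.RingSolver using (solve-∀)
  open import Data.Empty using (⊥-elim)
  open import Data.Unit using (tt)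
  open import Data.Product using (_,_; proj₁; proj₂; ∃-syntax; _×_)
  open import Data.Sum using (inj₁; inj₂)
  open import Relation.Binary.PropositionalEquality
  open import Relation.Nullary.Decidable using (map′; _×-dec_)
  open import Relation.Unary using (Decidable)
  open NaturalArithmetic
  open Progressions using (gammaSize⇒alphaSize)
  open Reduction k l 0<l l<k

  IsIntervalValue : ℕ → ℕ → ℕ → ℕ → Set
  IsIntervalValue v d q m = n ≡ q * d × IntervalSize d m × v ≡ m * q

  IntervalValues : ℕ → Set
  IntervalValues v = ∃[ d ] ∃[ q ] ∃[ m ] IsIntervalValue v d q m

  factors≤ : ∀ {q d} → n ≡ q * d → q ≤ n × d ≤ n
  factors≤ {zero}  {d}     n≡0   = ⊥-elim (<⇒≢ 0<n (sym n≡0))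
  factors≤ {suc q} {zero}  n≡q*0 = ⊥-elim (<⇒≢ 0<n (sym (trans n≡q*0 (*-zeroʳ (suc q)))))
  factors≤ {suc q} {suc d} n≡q*d = subst (suc q ≤_) (sym n≡q*d) (m≤m*n (suc q) (suc d)) ,
                                   subst (suc d ≤_) (sym n≡q*d) (m≤n*m (suc d) (suc q))

  intervalValues? : Decidable IntervalValues
  intervalValues? v = map′ unbounded bounded
    (anyUpTo? (λ d → anyUpTo? (λ q → anyUpTo? (λ m →
      n ≟ q * d ×-dec intervalSize? d m ×-dec v ≟ m * q) (suc n)) (suc n)) (suc n))
    where
    BoundedValue : Set
    BoundedValue = ∃[ d ] (d < suc n × ∃[ q ] (q < suc n × ∃[ m ] (m < suc n × IsIntervalValue v d q m)))
    unbounded : BoundedValue → IntervalValues v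
    unbounded (d , _ , q , _ , m , _ , value) = d , q , m , value
    bounded : IntervalValues v → BoundedValue
    bounded (d , q , m , n≡q*d , I , v≡m*q) with factors≤ n≡q*d
    ... | q≤n , d≤n =
      d , s≤s d≤n , q , s≤s q≤n , m , s≤s (≤-trans (intervalSize≤ m I) d≤n) , n≡q*d , I , v≡m*q

  intervalValue≤n : ∀ v → IntervalValues v → v ≤ n
  intervalValue≤n v (d , q , m , n≡q*d , I , v≡m*q) = begin
    v     ≡⟨ v≡m*q ⟩
    m * q ≤⟨ *-monoˡ-≤ q (intervalSize≤ m I) ⟩
    d * q ≡⟨ *-comm d q ⟩
    q * d ≡⟨ n≡q*d ⟨
    n     ∎
    where open ≤-Reasoning

  maxIntervalValue : ∃[ M ] IsMax IntervalValues M
  maxIntervalValue =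
    bounded⇒max intervalValues? n (0 , n , 1 , 0 , sym (*-identityˡ n) , tt , refl) intervalValue≤n

  module _ {M : ℕ} (M-max : IsMax IntervalValues M) where

    alphaSize-scaled≤ : ∀ {d q w} → n ≡ q * d → AlphaSizes d k l w → w * q ≤ M
    alphaSize-scaled≤ n≡q*d (inj₁ refl) = z≤n
    alphaSize-scaled≤ {d} {q} {w} n≡q*d (inj₂ (a , b , ap , sf)) with sumFreeAP⇒dominated 0<d ap sf
      where 0<d = n≢0⇒n>0 λ { refl → <⇒≢ 0<n (sym (trans n≡q*d (*-zeroʳ q))) }
    ... | d′ , p , m′ , d≡p*d′ , w≤m′*p , I = begin
      w * q        ≤⟨ *-monoˡ-≤ q w≤m′*p ⟩
      m′ * p * q   ≡⟨ *-assoc m′ p q ⟩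
      m′ * (p * q) ≤⟨ proj₂ M-max _ (d′ , p * q , m′ , n≡[p*q]*d′ , I , refl) ⟩
      M            ∎
      where
      open ≤-Reasoning
      n≡[p*q]*d′ : n ≡ p * q * d′
      n≡[p*q]*d′ = trans n≡q*d (trans (cong (q *_) d≡p*d′) (regroup q p d′))
        where
        regroup : ∀ q p d′ → q * (p * d′) ≡ p * q * d′
        regroup = solve-∀

    intervalValue⇒alpha : ∀ {d q m} → IsIntervalValue M d q m → IsAlpha d k l m
    intervalValue⇒alpha {d} {q} {m} (n≡q*d , I , M≡m*q) =
      gammaSize⇒alphaSize (intervalSize⇒gammaSize m I) ,
      λ w w∈α → *-cancelʳ-≤ w m q ⦃ q≢0 ⦄ (subst (w * q ≤_) M≡m*q (alphaSize-scaled≤ n≡q*d w∈α))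
      where q≢0 = ≢-nonZero λ { refl → <⇒≢ 0<n (sym n≡q*d) }

    intervalValue⇒gamma : ∀ {d q m} → IsIntervalValue M d q m → IsGamma d k l m
    intervalValue⇒gamma {m = m} value@(_ , I , _) =
      intervalSize⇒gammaSize m I ,
      λ w w∈γ → proj₂ (intervalValue⇒alpha value) w (gammaSize⇒alphaSize w∈γ)

    intervalMax⇒alphaMax : IsMax (AlphaValues n k l) M
    intervalMax⇒alphaMax with proj₁ M-max
    ... | d , q , m , value@(n≡q*d , _ , M≡m*q) =
      (d , q , m , n≡q*d , intervalValue⇒alpha value , M≡m*q) ,
      λ { w (_ , _ , _ , n≡q′*d′ , (w∈α , _) , w≡m′*q′) →
          subst (_≤ M) (sym w≡m′*q′) (alphaSize-scaled≤ n≡q′*d′ w∈α) }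

    intervalMax⇒gammaMax : IsMax (GammaValues n k l) M
    intervalMax⇒gammaMax with proj₁ M-max
    ... | d , q , m , value@(n≡q*d , _ , M≡m*q) =
      (d , q , m , n≡q*d , intervalValue⇒gamma value , M≡m*q) ,
      λ { w (_ , _ , _ , n≡q′*d′ , (w∈γ , _) , w≡m′*q′) →
          subst (_≤ M) (sym w≡m′*q′) (alphaSize-scaled≤ n≡q′*d′ (gammaSize⇒alphaSize w∈γ)) }

theorem9 : (n k l : ℕ) → 0 < n → 0 < l → l < k →
    ∃[ M ] (IsMax (AlphaValues n k l) M × IsMax (GammaValues n k l) M)
theorem9 n k l 0<n 0<l l<k = M , intervalMax⇒alphaMax M-max , intervalMax⇒gammaMax M-max
  where
  open MaximalValues n k l 0<n 0<l l<k
  M = proj₁ maxIntervalValue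
  M-max = proj₂ maxIntervalValue
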